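{- Let $G=(V,E)$ be a simple undirected graph, let $S\subseteq\binom{V}{2}$ be a set of terminal pairs and $\{s,t\}\in S$. Then: (i) for each $vw\in E$ the inequality $x_{vw}\geq 1$ if $\{v,w\}\in S$, respectively $x_{vw}\geq 0$ otherwise, is facet-defining for $\mathrm{MultC}(G,S)$; (ii) for each $s$-$t$-path $P\subseteq G$ such that there is no $\{s',t'\}\in S$ with $s',t'\in V(P)$ and $\{s',t'\}\neq\{s,t\}$, the inequality $\sum_{e\in E(P)}x_e\geq 1$ is facet-defining for $\mathrm{MultC}(G,S)$.
   Context: Given a graph $G=(V,E)$ and $S\subseteq\binom{V}{2}$, an ($S$-)multicut is a set $\delta\subseteq E$ such that for every $\{s,t\}\in S$ the nodes $s$ and $t$ lie in different components of $G-\delta$. For $F\subseteq E$, $x^F\in\mathbb{R}^E$ is its incidence vector. The multicut dominant is $\mathrm{MultC}(G,S)=\mathrm{conv}\{x^\delta:\delta\text{ an } S\text{ -multicut}\}+\mathbb{R}^E_{\geq 0}$.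
   Formalization: The multicut dominant $\mathrm{MultC}(G,S)$ and the facet-defining property are taken over the rationals, with points in ℚ^E instead of ℝ^E. -}

module Defs where

open import Data.Nat using (ℕ; zero; suc)
open import Data.Fin using (Fin; zero; suc; inject₁)
open import Data.Bool using (Bool; true; false)
open import Data.Product using (Σ; ∃; _×_; _,_)
open import Data.Sum using (_⊎_)
open import Data.Empty using (⊥)
open import Relation.Nullary using (¬_)
open import Relation.Binary.PropositionalEquality using (_≡_; _≢_)
open import Data.Rational using (ℚ; 0ℚ; 1ℚ; _+_; _*_; _≤_)

Σℚ : (k : ℕ) → (Fin k → ℚ) → ℚ
Σℚ zero    f = 0ℚ
Σℚ (suc k) f = f zero + Σℚ k (λ i → f (suc i))

Vecℚ : ℕ → Set
Vecℚ m = Fin m → ℚ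

_·_ : {m : ℕ} → Vecℚ m → Vecℚ m → ℚ
_·_ {m} a x = Σℚ m (λ e → a e * x e)

record Graph : Set where
  field
    n      : ℕ
    m      : ℕ
    end₁   : Fin m → Fin n
    end₂   : Fin m → Fin n

open Graph public

Joins : (G : Graph) → Fin (m G) → Fin (n G) → Fin (n G) → Set
Joins G e u w = (end₁ G e ≡ u × end₂ G e ≡ w) ⊎ (end₁ G e ≡ w × end₂ G e ≡ u)

IsSimple : Graph → Set
IsSimple G =
  (∀ e → end₁ G e ≢ end₂ G e) ×
  (∀ e f → Joins G f (end₁ G e) (end₂ G e) → e ≡ f)

-- A set S ⊆ (V choose 2) of terminal pairs, given as a relation that is
-- symmetric and irreflexive ({s,t} ∈ S  ⇔  S s t  ⇔  S t s).
IsPairSet : (G : Graph) → (Fin (n G) → Fin (n G) → Set) → Set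
IsPairSet G S = (∀ s t → S s t → S t s) × (∀ s → ¬ S s s)

EdgeSet : Graph → Set
EdgeSet G = Fin (m G) → Bool

incidence : (G : Graph) → EdgeSet G → Vecℚ (m G)
incidence G δ e with δ e
... | true  = 1ℚ
... | false = 0ℚ

-- u and v lie in the same component of G - δ
data Connected (G : Graph) (δ : EdgeSet G) : Fin (n G) → Fin (n G) → Set where
  here : ∀ {u} → Connected G δ u u
  step : ∀ {u w v} (e : Fin (m G)) → δ e ≡ false → Joins G e u w →
         Connected G δ w v → Connected G δ u v

IsMulticut : (G : Graph) → (Fin (n G) → Fin (n G) → Set) → EdgeSet G → Set
IsMulticut G S δ = ∀ s t → S s t → ¬ Connected G δ s t

-- The multicut dominant MultC(G,S) = conv{x^δ} + ℝ^E_{≥0} (over ℚ):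
-- x is ≥ (componentwise) a convex combination of incidence vectors of multicuts.
MultC : (G : Graph) → (Fin (n G) → Fin (n G) → Set) → Vecℚ (m G) → Set
MultC G S x =
  Σ ℕ λ r → Σ (Fin r → EdgeSet G) λ δ → Σ (Fin r → ℚ) λ λ' →
    (∀ j → IsMulticut G S (δ j)) ×
    (∀ j → 0ℚ ≤ λ' j) ×
    (Σℚ r λ' ≡ 1ℚ) ×
    (∀ e → Σℚ r (λ j → λ' j * incidence G (δ j) e) ≤ x e)

AffIndep : {m k : ℕ} → (Fin k → Vecℚ m) → Set
AffIndep {m} {k} p =
  ∀ (μ : Fin k → ℚ) → Σℚ k μ ≡ 0ℚ →
    (∀ e → Σℚ k (λ i → μ i * p i e) ≡ 0ℚ) → ∀ i → μ i ≡ 0ℚ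

HasAffIndep : {m : ℕ} → (Vecℚ m → Set) → ℕ → Set
HasAffIndep {m} P k =
  Σ (Fin k → Vecℚ m) λ p → (∀ i → P (p i)) × AffIndep p

-- the maximum number of affinely independent points of P is k,
-- i.e. dim P = k - 1 (dim ∅ = -1)
DimPlusOne : {m : ℕ} → (Vecℚ m → Set) → ℕ → Set
DimPlusOne P k = HasAffIndep P k × ¬ HasAffIndep P (suc k)

Valid : {m : ℕ} → (Vecℚ m → Set) → Vecℚ m → ℚ → Set
Valid P a b = ∀ x → P x → b ≤ a · x

Face : {m : ℕ} → (Vecℚ m → Set) → Vecℚ m → ℚ → Vecℚ m → Set
Face P a b x = P x × (a · x ≡ b)

FacetDefining : {m : ℕ} → (Vecℚ m → Set) → Vecℚ m → ℚ → Set
FacetDefining P a b =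
  Valid P a b × Σ ℕ λ k → DimPlusOne P (suc k) × DimPlusOne (Face P a b) k

unitVec : {m : ℕ} → Fin m → Vecℚ m
unitVec zero    zero    = 1ℚ
unitVec zero    (suc _) = 0ℚ
unitVec (suc _) zero    = 0ℚ
unitVec (suc e) (suc f) = unitVec e f

pathVec : {m k : ℕ} → (Fin k → Fin m) → Vecℚ m
pathVec {m} {k} es f = Σℚ k (λ i → unitVec (es i) f)

record Path (G : Graph) (s t : Fin (n G)) : Set where
  field
    len   : ℕ
    vert  : Fin (suc len) → Fin (n G)
    edge  : Fin len → Fin (m G)
    start : vert zero ≡ s
    stop  : vert (Data.Fin.fromℕ len) ≡ t
    injV  : ∀ i j → vert i ≡ vert j → i ≡ j
    joins : ∀ i → Joins G (edge i) (vert (inject₁ i)) (vert (suc i))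

OnPath : {G : Graph} {s t : Fin (n G)} → Path G s t → Fin (n G) → Set
OnPath P v = ∃ λ i → Path.vert P i ≡ v

Fin' : Graph → Set
Fin' G = Fin (n G)

EdgeIx : Graph → Set
EdgeIx G = Fin (m G)

-- MultC(G,S) is full-dimensional: the all-ones vector x^E and the points x^E + e_f are
-- m + 1 affinely independent points of it. Each inequality a·x ≥ b has a ≥ 0 and holds on
-- every multicut (a multicut contains every terminal edge and meets every s-t path), hence
-- on the dominant. For a facet it then suffices to find m affinely independent points on
-- the face. For x_e ≥ b take a multicut δ with x^δ_e = b (all edges, or all edges but e)
-- and the points x^δ and x^δ + e_f, f ≠ e. For the path inequality take the multicuts
-- δ_j = (E ∖ E(P)) ∪ {e_j}: removing e_j splits P into two subpaths, and since {s,t} is the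
-- only terminal pair on P and s, t lie on different subpaths, δ_j is a multicut. The points
-- x^{δ_j} for e_j ∈ E(P) and x^{δ_{j₀}} + e_f for f ∉ E(P) lie on the face.
module Submission where

open import Defs
open import Data.Nat as ℕ using (zero; suc; s≤s)
import Data.Nat.Properties as ℕₚ
open import Data.Fin as Fin using (Fin; zero; suc; punchIn; toℕ; inject₁; fromℕ; fromℕ<)
open import Data.Fin.Properties
  using (any?; toℕ-injective; toℕ-inject₁; toℕ-fromℕ; toℕ<n; inject₁-injective)
  renaming (_≟_ to _≟ᶠ_)
open import Data.Vec.Functional using (_∷_; insertAt)
open import Data.Vec.Functional.Properties using (insertAt-lookup; insertAt-punchIn)
open import Data.Bool using (true; false; not; _∨_)
open import Data.Bool.Properties using (¬-not) renaming (_≟_ to _≟ᵇ_)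
open import Data.Product using (Σ; ∃; _×_; _,_; proj₁; proj₂)
open import Data.Sum using (_⊎_; inj₁; inj₂)
open import Data.Empty using (⊥; ⊥-elim)
open import Function using (_∘_)
open import Relation.Nullary using (¬_; Dec; yes; no; ¬?; does; contradiction)
open import Relation.Nullary.Decidable using (dec-true; toWitness)
open import Relation.Binary using (tri<; tri≈; tri>)
open import Relation.Binary.PropositionalEquality
open import Data.Rational
  using (ℚ; 0ℚ; 1ℚ; _+_; _*_; _-_; -_; _≤_; _<_; 1/_; ≢-nonZero; nonNegative)
open import Data.Rational.Properties
open import Data.Rational.Solver using (module +-*-Solver)
open +-*-Solver

0≤1 : 0ℚ ≤ 1ℚ
0≤1 = toWitness {a? = 0ℚ ≤? 1ℚ} _

p≤p+q : ∀ p {q} → 0ℚ ≤ q → p ≤ p + q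
p≤p+q p {q} q≥0 = subst (_≤ p + q) (+-identityʳ p) (+-monoʳ-≤ p q≥0)

*-nonNeg : ∀ {p q} → 0ℚ ≤ p → 0ℚ ≤ q → 0ℚ ≤ p * q
*-nonNeg {p} {q} p≥0 q≥0 = subst (_≤ p * q) (*-zeroʳ p) (*-monoˡ-≤-nonNeg p {{nonNegative p≥0}} q≥0)

p*q≡0⇒p≡0 : ∀ {p q} → q ≢ 0ℚ → p * q ≡ 0ℚ → p ≡ 0ℚ
p*q≡0⇒p≡0 {p} {q} q≢0 pq≡0 = begin
  p                ≡⟨ sym (*-identityʳ p) ⟩
  p * 1ℚ           ≡⟨ cong (p *_) (sym (*-inverseʳ q)) ⟩
  p * (q * 1/ q)   ≡⟨ sym (*-assoc p q (1/ q)) ⟩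
  (p * q) * 1/ q   ≡⟨ cong (_* 1/ q) pq≡0 ⟩
  0ℚ * 1/ q        ≡⟨ *-zeroˡ (1/ q) ⟩
  0ℚ               ∎
  where
  open ≡-Reasoning
  instance q≠0 = ≢-nonZero q≢0

Σℚ-cong : ∀ k {f g : Fin k → ℚ} → (∀ i → f i ≡ g i) → Σℚ k f ≡ Σℚ k g
Σℚ-cong zero    f≗g = refl
Σℚ-cong (suc k) f≗g = cong₂ _+_ (f≗g zero) (Σℚ-cong k (f≗g ∘ suc))

Σℚ-zero : ∀ k {f : Fin k → ℚ} → (∀ i → f i ≡ 0ℚ) → Σℚ k f ≡ 0ℚ
Σℚ-zero zero    f≗0 = refl
Σℚ-zero (suc k) f≗0 = cong₂ _+_ (f≗0 zero) (Σℚ-zero k (f≗0 ∘ suc))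

Σℚ-*-zeroʳ : ∀ k (f : Fin k → ℚ) {g : Fin k → ℚ} → (∀ i → g i ≡ 0ℚ) → Σℚ k (λ i → f i * g i) ≡ 0ℚ
Σℚ-*-zeroʳ k f g≗0 = Σℚ-zero k (λ i → trans (cong (f i *_) (g≗0 i)) (*-zeroʳ (f i)))

Σℚ-distrib-+ : ∀ k (f g : Fin k → ℚ) → Σℚ k (λ i → f i + g i) ≡ Σℚ k f + Σℚ k g
Σℚ-distrib-+ zero    f g = refl
Σℚ-distrib-+ (suc k) f g = trans (cong (f zero + g zero +_) (Σℚ-distrib-+ k (f ∘ suc) (g ∘ suc)))
  (solve 4 (λ a b c d → (a :+ b) :+ (c :+ d) := (a :+ c) :+ (b :+ d)) refl
     (f zero) (g zero) (Σℚ k (f ∘ suc)) (Σℚ k (g ∘ suc)))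

Σℚ-*ˡ : ∀ k c (f : Fin k → ℚ) → Σℚ k (λ i → c * f i) ≡ c * Σℚ k f
Σℚ-*ˡ zero    c f = sym (*-zeroʳ c)
Σℚ-*ˡ (suc k) c f = trans (cong (c * f zero +_) (Σℚ-*ˡ k c (f ∘ suc))) (sym (*-distribˡ-+ c _ _))

Σℚ-*ʳ : ∀ k c (f : Fin k → ℚ) → Σℚ k (λ i → f i * c) ≡ Σℚ k f * c
Σℚ-*ʳ k c f = trans (Σℚ-cong k (λ i → *-comm (f i) c)) (trans (Σℚ-*ˡ k c f) (*-comm c _))

Σℚ-neg : ∀ k (f : Fin k → ℚ) → Σℚ k (λ i → - f i) ≡ - Σℚ k f
Σℚ-neg zero    f = refl
Σℚ-neg (suc k) f = trans (cong (- f zero +_) (Σℚ-neg k (f ∘ suc))) (sym (neg-distrib-+ (f zero) _))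

Σℚ-distrib-- : ∀ k (f g : Fin k → ℚ) → Σℚ k (λ i → f i - g i) ≡ Σℚ k f - Σℚ k g
Σℚ-distrib-- k f g = trans (Σℚ-distrib-+ k f (λ i → - g i)) (cong (Σℚ k f +_) (Σℚ-neg k g))

Σℚ-comm : ∀ k l (f : Fin k → Fin l → ℚ) →
  Σℚ k (λ i → Σℚ l (f i)) ≡ Σℚ l (λ j → Σℚ k (λ i → f i j))
Σℚ-comm zero    l f = sym (Σℚ-zero l (λ _ → refl))
Σℚ-comm (suc k) l f = trans (cong (Σℚ l (f zero) +_) (Σℚ-comm k l (f ∘ suc)))
  (sym (Σℚ-distrib-+ l (f zero) (λ j → Σℚ k (λ i → f (suc i) j))))

Σℚ-remove : ∀ k (p : Fin (suc k)) (f : Fin (suc k) → ℚ) →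
  Σℚ (suc k) f ≡ f p + Σℚ k (f ∘ punchIn p)
Σℚ-remove k       zero    f = refl
Σℚ-remove (suc k) (suc p) f = trans (cong (f zero +_) (Σℚ-remove k p (f ∘ suc)))
  (solve 3 (λ a b c → a :+ (b :+ c) := b :+ (a :+ c)) refl (f zero) (f (suc p)) _)

Σℚ-mono-≤ : ∀ k {f g : Fin k → ℚ} → (∀ i → f i ≤ g i) → Σℚ k f ≤ Σℚ k g
Σℚ-mono-≤ zero    f≤g = ≤-refl
Σℚ-mono-≤ (suc k) f≤g = +-mono-≤ (f≤g zero) (Σℚ-mono-≤ k (f≤g ∘ suc))

Σℚ-nonNeg : ∀ k {f : Fin k → ℚ} → (∀ i → 0ℚ ≤ f i) → 0ℚ ≤ Σℚ k f
Σℚ-nonNeg k {f} f≥0 = subst (_≤ Σℚ k f) (Σℚ-zero k (λ _ → refl)) (Σℚ-mono-≤ k f≥0)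

term≤Σℚ : ∀ k {f : Fin k → ℚ} → (∀ i → 0ℚ ≤ f i) → ∀ p → f p ≤ Σℚ k f
term≤Σℚ (suc k) {f} f≥0 p = begin
  f p                        ≤⟨ p≤p+q (f p) (Σℚ-nonNeg k (f≥0 ∘ punchIn p)) ⟩
  f p + Σℚ k (f ∘ punchIn p) ≡⟨ sym (Σℚ-remove k p f) ⟩
  Σℚ (suc k) f               ∎
  where open ≤-Reasoning

unitVec-diag : ∀ {m} (e : Fin m) → unitVec e e ≡ 1ℚ
unitVec-diag zero    = refl
unitVec-diag (suc e) = unitVec-diag e

unitVec-off : ∀ {m} {e f : Fin m} → e ≢ f → unitVec e f ≡ 0ℚ
unitVec-off {e = zero}  {zero}  e≢f = contradiction refl e≢f
unitVec-off {e = zero}  {suc f} e≢f = refl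
unitVec-off {e = suc e} {zero}  e≢f = refl
unitVec-off {e = suc e} {suc f} e≢f = unitVec-off (e≢f ∘ cong suc)

unitVec-comm : ∀ {m} (e f : Fin m) → unitVec e f ≡ unitVec f e
unitVec-comm zero    zero    = refl
unitVec-comm zero    (suc f) = refl
unitVec-comm (suc e) zero    = refl
unitVec-comm (suc e) (suc f) = unitVec-comm e f

unitVec-nonNeg : ∀ {m} (e f : Fin m) → 0ℚ ≤ unitVec e f
unitVec-nonNeg zero    zero    = 0≤1
unitVec-nonNeg zero    (suc f) = ≤-refl
unitVec-nonNeg (suc e) zero    = ≤-refl
unitVec-nonNeg (suc e) (suc f) = unitVec-nonNeg e f

Σℚ-unitVecˡ : ∀ k (j : Fin k) (f : Fin k → ℚ) → Σℚ k (λ i → unitVec j i * f i) ≡ f j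
Σℚ-unitVecˡ (suc k) zero    f = trans
  (cong₂ _+_ (*-identityˡ (f zero)) (Σℚ-zero k (λ i → *-zeroˡ (f (suc i))))) (+-identityʳ (f zero))
Σℚ-unitVecˡ (suc k) (suc j) f = trans
  (cong₂ _+_ (*-zeroˡ (f zero)) (Σℚ-unitVecˡ k j (f ∘ suc))) (+-identityˡ (f (suc j)))

Σℚ-unitVecʳ : ∀ k (j : Fin k) (f : Fin k → ℚ) → Σℚ k (λ i → f i * unitVec i j) ≡ f j
Σℚ-unitVecʳ k j f = trans
  (Σℚ-cong k (λ i → trans (*-comm (f i) _) (cong (_* f i) (unitVec-comm i j)))) (Σℚ-unitVecˡ k j f)

Σℚ-unitVec : ∀ k (j : Fin k) → Σℚ k (unitVec j) ≡ 1ℚ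
Σℚ-unitVec k j = trans (Σℚ-cong k (λ i → sym (*-identityʳ (unitVec j i)))) (Σℚ-unitVecˡ k j (λ _ → 1ℚ))

lincomb : ∀ {m k} → (Fin k → ℚ) → (Fin k → Vecℚ m) → Vecℚ m
lincomb {k = k} μ v e = Σℚ k (λ i → μ i * v i e)

·-unitVecˡ : ∀ {m} (e : Fin m) (x : Vecℚ m) → unitVec e · x ≡ x e
·-unitVecˡ {m} = Σℚ-unitVecˡ m

·-lincomb : ∀ {m} k (a : Vecℚ m) (μ : Fin k → ℚ) (v : Fin k → Vecℚ m) →
  a · lincomb μ v ≡ Σℚ k (λ i → μ i * (a · v i))
·-lincomb {m} k a μ v = begin
  Σℚ m (λ e → a e * Σℚ k (λ i → μ i * v i e))
    ≡⟨ Σℚ-cong m (λ e → sym (Σℚ-*ˡ k (a e) _)) ⟩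
  Σℚ m (λ e → Σℚ k (λ i → a e * (μ i * v i e)))
    ≡⟨ Σℚ-comm m k _ ⟩
  Σℚ k (λ i → Σℚ m (λ e → a e * (μ i * v i e)))
    ≡⟨ Σℚ-cong k (λ i → trans (Σℚ-cong m (λ e → swap-left (a e) (μ i) (v i e))) (Σℚ-*ˡ m (μ i) _)) ⟩
  Σℚ k (λ i → μ i * (a · v i)) ∎
  where
  open ≡-Reasoning
  swap-left : ∀ x y z → x * (y * z) ≡ y * (x * z)
  swap-left = solve 3 (λ x y z → x :* (y :* z) := y :* (x :* z)) refl

·-distrib-- : ∀ {m} (a x y : Vecℚ m) → a · (λ e → x e - y e) ≡ a · x - a · y
·-distrib-- {m} a x y = trans
  (Σℚ-cong m (λ e → solve 3 (λ p q r → p :* (q :- r) := p :* q :- p :* r) refl (a e) (x e) (y e)))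
  (Σℚ-distrib-- m _ _)

·-monoʳ-≤ : ∀ {m} {a x y : Vecℚ m} → (∀ e → 0ℚ ≤ a e) → (∀ e → x e ≤ y e) → a · x ≤ a · y
·-monoʳ-≤ {m} {a} a≥0 x≤y = Σℚ-mono-≤ m (λ e → *-monoˡ-≤-nonNeg (a e) {{nonNegative (a≥0 e)}} (x≤y e))

·-self≢0 : ∀ {m} {a : Vecℚ m} (e : Fin m) → (∀ f → 0ℚ ≤ a f) → a e ≡ 1ℚ → a · a ≢ 0ℚ
·-self≢0 {m} {a} e a≥0 ae≡1 a·a≡0 = <-irrefl refl (<-≤-trans 0<1 (begin
  1ℚ            ≡⟨ sym (cong₂ _*_ ae≡1 ae≡1) ⟩
  a e * a e     ≤⟨ term≤Σℚ m (λ f → *-nonNeg (a≥0 f) (a≥0 f)) e ⟩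
  a · a         ≡⟨ a·a≡0 ⟩
  0ℚ            ∎))
  where
  open ≤-Reasoning
  0<1 : 0ℚ < 1ℚ
  0<1 = toWitness {a? = 0ℚ <? 1ℚ} _

LinearlyDependent : ∀ {m k} → (Fin k → Vecℚ m) → Set
LinearlyDependent {m} {k} v =
  Σ (Fin k → ℚ) λ μ → (∀ e → lincomb μ v e ≡ 0ℚ) × ∃ λ i → μ i ≢ 0ℚ

linearlyDependent-tail : ∀ {m k} (v : Fin k → Vecℚ (suc m)) → (∀ i → v i zero ≡ 0ℚ) →
  LinearlyDependent (λ i → v i ∘ suc) → LinearlyDependent v
linearlyDependent-tail v v₀≡0 (μ , μv≡0 , nontrivial) = μ , μv≡0′ , nontrivial
  where
  μv≡0′ : ∀ e → lincomb μ v e ≡ 0ℚ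
  μv≡0′ zero    = Σℚ-*-zeroʳ _ μ v₀≡0
  μv≡0′ (suc e) = μv≡0 e

-- One step of Gaussian elimination: clear the first coordinate of every vector
-- other than the pivot v p, where ic is the inverse of v p zero.
eliminate : ∀ {m k} → (Fin (suc k) → Vecℚ (suc m)) → Fin (suc k) → ℚ → Fin k → Vecℚ m
eliminate v p ic j e = v (punchIn p j) (suc e) - (v (punchIn p j) zero * ic) * v p (suc e)

-- The pivot gets the coefficient α that cancels the first coordinate; the remaining
-- coordinates of the combination are those of the relation among the eliminated vectors.
linearlyDependent-eliminate : ∀ {m k} (v : Fin (suc k) → Vecℚ (suc m)) (p : Fin (suc k)) (ic : ℚ) →
  ic * v p zero ≡ 1ℚ → LinearlyDependent (eliminate v p ic) → LinearlyDependent v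
linearlyDependent-eliminate {m} {k} v p ic ic*c≡1 (ν , νw≡0 , (j₀ , νj₀≢0)) =
  μ , μv≡0 , (punchIn p j₀ , λ μ≡0 → νj₀≢0 (trans (sym (insertAt-punchIn ν p α j₀)) μ≡0))
  where
  r : Fin k → ℚ
  r j = v (punchIn p j) zero * ic
  B = Σℚ k (λ j → ν j * r j)
  α = - B
  μ = insertAt ν p α
  A : Fin (suc m) → ℚ
  A e = Σℚ k (λ j → ν j * v (punchIn p j) e)

  μv≡ : ∀ e → lincomb μ v e ≡ α * v p e + A e
  μv≡ e = trans (Σℚ-remove k p (λ i → μ i * v i e))
    (cong₂ _+_ (cong (_* v p e) (insertAt-lookup ν p α))
               (Σℚ-cong k (λ j → cong (_* v (punchIn p j) e) (insertAt-punchIn ν p α j))))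

  B≡ : B ≡ A zero * ic
  B≡ = trans (Σℚ-cong k (λ j → sym (*-assoc (ν j) _ ic))) (Σℚ-*ʳ k ic _)

  νw≡ : ∀ e → lincomb ν (eliminate v p ic) e ≡ A (suc e) - B * v p (suc e)
  νw≡ e = trans
    (Σℚ-cong k (λ j → solve 4 (λ n a b x → n :* (a :- b :* x) := n :* a :- (n :* b) :* x) refl
       (ν j) (v (punchIn p j) (suc e)) (r j) (v p (suc e))))
    (trans (Σℚ-distrib-- k _ _) (cong (_-_ (A (suc e))) (Σℚ-*ʳ k (v p (suc e)) _)))

  μv≡0 : ∀ e → lincomb μ v e ≡ 0ℚ
  μv≡0 zero = begin
    lincomb μ v zero
      ≡⟨ μv≡ zero ⟩
    - B * v p zero + A zero
      ≡⟨ cong (λ b → - b * v p zero + A zero) B≡ ⟩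
    - (A zero * ic) * v p zero + A zero
      ≡⟨ solve 3 (λ a i c → :- (a :* i) :* c :+ a := a :- a :* (i :* c)) refl (A zero) ic (v p zero) ⟩
    A zero - A zero * (ic * v p zero)
      ≡⟨ cong (λ z → A zero - A zero * z) ic*c≡1 ⟩
    A zero - A zero * 1ℚ
      ≡⟨ solve 1 (λ a → a :- a :* con 1ℚ := con 0ℚ) refl (A zero) ⟩
    0ℚ ∎
    where open ≡-Reasoning
  μv≡0 (suc e) = begin
    lincomb μ v (suc e)
      ≡⟨ μv≡ (suc e) ⟩
    - B * v p (suc e) + A (suc e)
      ≡⟨ solve 3 (λ b x a → :- b :* x :+ a := a :- b :* x) refl B (v p (suc e)) (A (suc e)) ⟩
    A (suc e) - B * v p (suc e)
      ≡⟨ sym (νw≡ e) ⟩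
    lincomb ν (eliminate v p ic) e
      ≡⟨ νw≡0 e ⟩
    0ℚ ∎
    where open ≡-Reasoning

<-dim⇒linearlyDependent : ∀ m {k} → m ℕ.< k → (v : Fin k → Vecℚ m) → LinearlyDependent v
<-dim⇒linearlyDependent zero    {suc k} _ v = (λ _ → 1ℚ) , (λ ()) , (zero , λ ())
<-dim⇒linearlyDependent (suc m) {suc k} (s≤s m<k) v with any? (λ i → ¬? (v i zero ≟ 0ℚ))
... | no noPivot = linearlyDependent-tail v v₀≡0
  (<-dim⇒linearlyDependent m (ℕₚ.m<n⇒m<1+n m<k) (λ i → v i ∘ suc))
  where
  v₀≡0 : ∀ i → v i zero ≡ 0ℚ
  v₀≡0 i with v i zero ≟ 0ℚ
  ... | yes vᵢ₀≡0 = vᵢ₀≡0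
  ... | no  vᵢ₀≢0 = contradiction (i , vᵢ₀≢0) noPivot
... | yes (p , c≢0) = linearlyDependent-eliminate v p (1/ c) (*-inverseˡ c)
  (<-dim⇒linearlyDependent m m<k (eliminate v p (1/ c)))
  where
  c = v p zero
  instance c≠0 = ≢-nonZero c≢0

differences : ∀ {m k} → (Fin (suc k) → Vecℚ m) → Fin k → Vecℚ m
differences p j e = p (suc j) e - p zero e

affIndep⇒differences-independent : ∀ {m k} (p : Fin (suc k) → Vecℚ m) → AffIndep p →
  (β : Fin k → ℚ) → (∀ e → lincomb β (differences p) e ≡ 0ℚ) → ∀ j → β j ≡ 0ℚ
affIndep⇒differences-independent {m} {k} p indep β βd≡0 j =
  indep (- Σℚ k β ∷ β) (+-inverseˡ (Σℚ k β)) μp≡0 (suc j)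
  where
  μp≡0 : ∀ e → lincomb (- Σℚ k β ∷ β) p e ≡ 0ℚ
  μp≡0 e = begin
    - Σℚ k β * p zero e + X
      ≡⟨ solve 3 (λ b x y → :- b :* x :+ y := y :- b :* x) refl (Σℚ k β) (p zero e) X ⟩
    X - Σℚ k β * p zero e
      ≡⟨ cong (_-_ X) (sym (Σℚ-*ʳ k (p zero e) β)) ⟩
    X - Σℚ k (λ j → β j * p zero e)
      ≡⟨ sym (Σℚ-distrib-- k _ _) ⟩
    Σℚ k (λ j → β j * p (suc j) e - β j * p zero e)
      ≡⟨ Σℚ-cong k (λ j → factor (β j) (p (suc j) e) (p zero e)) ⟩
    lincomb β (differences p) e
      ≡⟨ βd≡0 e ⟩
    0ℚ ∎
    where
    open ≡-Reasoning
    X = Σℚ k (λ j → β j * p (suc j) e)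
    factor : ∀ b x y → b * x - b * y ≡ b * (x - y)
    factor = solve 3 (λ b x y → b :* x :- b :* y := b :* (x :- y)) refl

¬affIndep-overfull : ∀ {m} (p : Fin (suc (suc m)) → Vecℚ m) → ¬ AffIndep p
¬affIndep-overfull {m} p indep
  with <-dim⇒linearlyDependent m ℕₚ.≤-refl (differences p)
... | β , βd≡0 , (j , βj≢0) = βj≢0 (affIndep⇒differences-independent p indep β βd≡0 j)

¬affIndep-hyperplane : ∀ {m} (a : Vecℚ m) (b : ℚ) → a · a ≢ 0ℚ → (p : Fin (suc m) → Vecℚ m) →
  (∀ i → a · p i ≡ b) → ¬ AffIndep p
¬affIndep-hyperplane {m} a b a·a≢0 p onHyperplane indep
  with <-dim⇒linearlyDependent m ℕₚ.≤-refl (a ∷ differences p)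
... | μ , μv≡0 , (i , μi≢0) = μi≢0 (μ≡0 i)
  where
  a·d≡0 : ∀ j → a · differences p j ≡ 0ℚ
  a·d≡0 j = trans (·-distrib-- a (p (suc j)) (p zero))
    (trans (cong₂ _-_ (onHyperplane (suc j)) (onHyperplane zero)) (+-inverseʳ b))
  μ₀≡0 : μ zero ≡ 0ℚ
  μ₀≡0 = p*q≡0⇒p≡0 a·a≢0 (begin
    μ zero * (a · a)
      ≡⟨ sym (+-identityʳ _) ⟩
    μ zero * (a · a) + 0ℚ
      ≡⟨ cong (μ zero * (a · a) +_) (sym (Σℚ-*-zeroʳ m (μ ∘ suc) a·d≡0)) ⟩
    μ zero * (a · a) + Σℚ m (λ j → μ (suc j) * (a · differences p j))
      ≡⟨ sym (·-lincomb (suc m) a μ (a ∷ differences p)) ⟩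
    a · lincomb μ (a ∷ differences p)
      ≡⟨ Σℚ-*-zeroʳ m a μv≡0 ⟩
    0ℚ ∎)
    where open ≡-Reasoning
  μ≡0 : ∀ i → μ i ≡ 0ℚ
  μ≡0 zero    = μ₀≡0
  μ≡0 (suc j) = affIndep⇒differences-independent p indep (μ ∘ suc) μd≡0 j
    where
    μd≡0 : ∀ e → lincomb (μ ∘ suc) (differences p) e ≡ 0ℚ
    μd≡0 e = trans (sym (+-identityˡ _)) (trans (cong₂ _+_ (sym μ₀a≡0) refl) (μv≡0 e))
      where
      μ₀a≡0 : μ zero * a e ≡ 0ℚ
      μ₀a≡0 = trans (cong (_* a e) μ₀≡0) (*-zeroˡ (a e))

fullDimensional-facet : ∀ {m} (P : Vecℚ m → Set) (a : Vecℚ m) (b : ℚ) → Valid P a b → a · a ≢ 0ℚ →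
  HasAffIndep P (suc m) → HasAffIndep (Face P a b) m → FacetDefining P a b
fullDimensional-facet P a b valid a·a≢0 full face =
  valid , _ , (full , λ (p , _ , indep) → ¬affIndep-overfull p indep) ,
  (face , λ (p , onFace , indep) → ¬affIndep-hyperplane a b a·a≢0 p (proj₂ ∘ onFace) indep)

affIndep-translate : ∀ {m k} (c : Vecℚ m) (q : Fin k → Vecℚ m) → AffIndep q →
  AffIndep (λ i e → c e + q i e)
affIndep-translate {m} {k} c q indep μ Σμ≡0 μp≡0 = indep μ Σμ≡0 μq≡0
  where
  μq≡0 : ∀ e → lincomb μ q e ≡ 0ℚ
  μq≡0 e = begin
    lincomb μ q e
      ≡⟨ sym (+-identityˡ _) ⟩
    0ℚ + lincomb μ q e
      ≡⟨ cong (_+ lincomb μ q e) (sym (trans (cong (_* c e) Σμ≡0) (*-zeroˡ (c e)))) ⟩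
    Σℚ k μ * c e + lincomb μ q e
      ≡⟨ cong (_+ lincomb μ q e) (sym (Σℚ-*ʳ k (c e) μ)) ⟩
    Σℚ k (λ i → μ i * c e) + lincomb μ q e
      ≡⟨ sym (Σℚ-distrib-+ k _ _) ⟩
    Σℚ k (λ i → μ i * c e + μ i * q i e)
      ≡⟨ Σℚ-cong k (λ i → sym (*-distribˡ-+ (μ i) (c e) (q i e))) ⟩
    Σℚ k (λ i → μ i * (c e + q i e))
      ≡⟨ μp≡0 e ⟩
    0ℚ ∎
    where open ≡-Reasoning

standardSimplex : ∀ {m} → Fin (suc m) → Vecℚ m
standardSimplex zero    _ = 0ℚ
standardSimplex (suc f)   = unitVec f

standardSimplex-affIndep : ∀ {m} → AffIndep (standardSimplex {m})
standardSimplex-affIndep {m} μ Σμ≡0 μp≡0 = μ≡0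
  where
  μ₊≡0 : ∀ e → μ (suc e) ≡ 0ℚ
  μ₊≡0 e = begin
    μ (suc e)
      ≡⟨ sym (Σℚ-unitVecʳ m e (μ ∘ suc)) ⟩
    Σℚ m (λ f → μ (suc f) * unitVec f e)
      ≡⟨ sym (+-identityˡ _) ⟩
    0ℚ + Σℚ m (λ f → μ (suc f) * unitVec f e)
      ≡⟨ cong (_+ Σℚ m (λ f → μ (suc f) * unitVec f e)) (sym (*-zeroʳ (μ zero))) ⟩
    lincomb μ standardSimplex e
      ≡⟨ μp≡0 e ⟩
    0ℚ ∎
    where open ≡-Reasoning
  μ≡0 : ∀ i → μ i ≡ 0ℚ
  μ≡0 zero    = trans (sym (+-identityʳ (μ zero))) (trans (cong (μ zero +_) (sym (Σℚ-zero m μ₊≡0))) Σμ≡0)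
  μ≡0 (suc e) = μ₊≡0 e

shearedBasis : ∀ {m} → Fin m → (Fin m → ℚ) → Fin m → Vecℚ m
shearedBasis h ψ f g = unitVec f g + ψ f * unitVec h g

-- The relation forces μ f = - (Σ μ ψ) · [f = h]; then Σ μ = 0 kills the h-th coefficient.
shearedBasis-affIndep : ∀ {m} (h : Fin m) (ψ : Fin m → ℚ) → AffIndep (shearedBasis h ψ)
shearedBasis-affIndep {m} h ψ μ Σμ≡0 μp≡0 = μ≡0
  where
  K = Σℚ m (λ f → μ f * ψ f)
  μ+K≡0 : ∀ g → μ g + K * unitVec h g ≡ 0ℚ
  μ+K≡0 g = begin
    μ g + K * unitVec h g
      ≡⟨ cong₂ _+_ (sym (Σℚ-unitVecʳ m g μ)) (sym (Σℚ-*ʳ m (unitVec h g) (λ f → μ f * ψ f))) ⟩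
    Σℚ m (λ f → μ f * unitVec f g) + Σℚ m (λ f → μ f * ψ f * unitVec h g)
      ≡⟨ sym (Σℚ-distrib-+ m _ _) ⟩
    Σℚ m (λ f → μ f * unitVec f g + μ f * ψ f * unitVec h g)
      ≡⟨ Σℚ-cong m (λ f → factor (μ f) (unitVec f g) (ψ f) (unitVec h g)) ⟩
    lincomb μ (shearedBasis h ψ) g
      ≡⟨ μp≡0 g ⟩
    0ℚ ∎
    where
    open ≡-Reasoning
    factor : ∀ a u p v → a * u + a * p * v ≡ a * (u + p * v)
    factor = solve 4 (λ a u p v → a :* u :+ a :* p :* v := a :* (u :+ p :* v)) refl
  μ≡0-off : ∀ g → g ≢ h → μ g ≡ 0ℚ
  μ≡0-off g g≢h = trans (sym (+-identityʳ (μ g)))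
    (trans (cong (μ g +_) (sym (trans (cong (K *_) (unitVec-off (g≢h ∘ sym))) (*-zeroʳ K)))) (μ+K≡0 g))
  μ≡μ*unitVec : ∀ f → μ f ≡ μ f * unitVec f h
  μ≡μ*unitVec f with f ≟ᶠ h
  ... | yes refl = trans (sym (*-identityʳ (μ f))) (cong (μ f *_) (sym (unitVec-diag f)))
  ... | no  f≢h  = begin
    μ f                ≡⟨ μ≡0-off f f≢h ⟩
    0ℚ                 ≡⟨ sym (*-zeroʳ (μ f)) ⟩
    μ f * 0ℚ           ≡⟨ cong (μ f *_) (sym (unitVec-off f≢h)) ⟩
    μ f * unitVec f h  ∎
    where open ≡-Reasoning
  μ≡0 : ∀ g → μ g ≡ 0ℚ
  μ≡0 g with g ≟ᶠ h
  ... | yes refl = trans (sym (Σℚ-unitVecʳ m g μ)) (trans (sym (Σℚ-cong m μ≡μ*unitVec)) Σμ≡0)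
  ... | no  g≢h  = μ≡0-off g g≢h

module _ (G : Graph) where

  Joins-endpoints : ∀ {e a b u w} → Joins G e a b → Joins G e u w → (u ≡ a × w ≡ b) ⊎ (u ≡ b × w ≡ a)
  Joins-endpoints (inj₁ (p , q)) (inj₁ (r , s)) = inj₁ (trans (sym r) p , trans (sym s) q)
  Joins-endpoints (inj₁ (p , q)) (inj₂ (r , s)) = inj₂ (trans (sym s) q , trans (sym r) p)
  Joins-endpoints (inj₂ (p , q)) (inj₁ (r , s)) = inj₂ (trans (sym r) p , trans (sym s) q)
  Joins-endpoints (inj₂ (p , q)) (inj₂ (r , s)) = inj₁ (trans (sym s) q , trans (sym r) p)

  Joins-return : ∀ {e u w v} → Joins G e u w → Joins G e w v → u ≡ v
  Joins-return uw wv with Joins-endpoints uw wv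
  ... | inj₁ (w≡u , v≡w) = sym (trans v≡w w≡u)
  ... | inj₂ (_ , v≡u)   = sym v≡u

  incidence-true : ∀ (δ : EdgeSet G) {e} → δ e ≡ true → incidence G δ e ≡ 1ℚ
  incidence-true δ {e} δe≡true with δ e
  ... | true = refl

  incidence-false : ∀ (δ : EdgeSet G) {e} → δ e ≡ false → incidence G δ e ≡ 0ℚ
  incidence-false δ {e} δe≡false with δ e
  ... | false = refl

  incidence-nonNeg : ∀ (δ : EdgeSet G) e → 0ℚ ≤ incidence G δ e
  incidence-nonNeg δ e with δ e
  ... | true  = 0≤1
  ... | false = ≤-refl

  module _ (S : Fin' G → Fin' G → Set) where

    multicut⇒MultC : ∀ {δ} → IsMulticut G S δ → {x : Vecℚ (m G)} →
      (∀ e → incidence G δ e ≤ x e) → MultC G S x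
    multicut⇒MultC {δ} cut x≥δ = 1 , (λ _ → δ) , (λ _ → 1ℚ) , (λ _ → cut) , (λ _ → 0≤1) , refl ,
      λ e → subst (_≤ _) (sym (trans (+-identityʳ _) (*-identityˡ _))) (x≥δ e)

    allEdges-multicut : (∀ s → ¬ S s s) → IsMulticut G S (λ _ → true)
    allEdges-multicut irrefl s t st conn = irrefl t (subst (λ u → S u t) (isolated conn) st)
      where
      isolated : ∀ {u v} → Connected G (λ _ → true) u v → u ≡ v
      isolated here           = refl
      isolated (step _ () _ _)

    MultC-fullDimensional : (∀ s → ¬ S s s) → HasAffIndep (MultC G S) (suc (m G))
    MultC-fullDimensional irrefl =
      (λ i e → 1ℚ + standardSimplex i e) ,
      (λ i → multicut⇒MultC (allEdges-multicut irrefl) (λ e → 1≤1+simplex i e)) ,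
      affIndep-translate (λ _ → 1ℚ) standardSimplex standardSimplex-affIndep
      where
      1≤1+simplex : ∀ i e → 1ℚ ≤ 1ℚ + standardSimplex i e
      1≤1+simplex zero    e = ≤-reflexive (sym (+-identityʳ 1ℚ))
      1≤1+simplex (suc f) e = p≤p+q 1ℚ (unitVec-nonNeg f e)

    terminalEdge-cut : ∀ {δ} → IsMulticut G S δ → ∀ e → S (end₁ G e) (end₂ G e) → δ e ≡ true
    terminalEdge-cut {δ} cut e terminal with δ e in δe
    ... | true  = refl
    ... | false = contradiction (step e δe (inj₁ (refl , refl)) here) (cut _ _ terminal)

    MultC-valid : ∀ {a b} → (∀ e → 0ℚ ≤ a e) →
      (∀ δ → IsMulticut G S δ → b ≤ a · incidence G δ) → Valid (MultC G S) a b
    MultC-valid {a} {b} a≥0 bound x (r , δ , λ′ , cut , λ′≥0 , Σλ′≡1 , x≥) = begin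
      b
        ≡⟨ sym (trans (Σℚ-*ʳ r b λ′) (trans (cong (_* b) Σλ′≡1) (*-identityˡ b))) ⟩
      Σℚ r (λ j → λ′ j * b)
        ≤⟨ Σℚ-mono-≤ r (λ j → *-monoˡ-≤-nonNeg (λ′ j) {{nonNegative (λ′≥0 j)}} (bound (δ j) (cut j))) ⟩
      Σℚ r (λ j → λ′ j * (a · incidence G (δ j)))
        ≡⟨ sym (·-lincomb r a λ′ (incidence G ∘ δ)) ⟩
      a · lincomb λ′ (incidence G ∘ δ)
        ≤⟨ ·-monoʳ-≤ a≥0 x≥ ⟩
      a · x ∎
      where open ≤-Reasoning

    -- The points x^δ + e_f (f ≠ e) together with x^δ.
    edgeFace-affIndep : ∀ {δ} → IsMulticut G S δ → ∀ e →
      HasAffIndep (Face (MultC G S) (unitVec e) (incidence G δ e)) (m G)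
    edgeFace-affIndep {δ} cut e =
      (λ f g → incidence G δ g + shearedBasis e ψ f g) ,
      (λ f → multicut⇒MultC cut (λ g → p≤p+q _ (sheared≥0 f g)) , onFace f) ,
      affIndep-translate (incidence G δ) (shearedBasis e ψ) (shearedBasis-affIndep e ψ)
      where
      ψ : Fin (m G) → ℚ
      ψ f = - unitVec e f
      sheared≥0 : ∀ f g → 0ℚ ≤ shearedBasis e ψ f g
      sheared≥0 f g with f ≟ᶠ e
      ... | yes refl = ≤-reflexive (sym (trans (cong (λ d → u + - d * u) (unitVec-diag f))
                                              (solve 1 (λ u → u :+ :- con 1ℚ :* u := con 0ℚ) refl u)))
        where u = unitVec f g
      ... | no  f≢e  = subst (0ℚ ≤_) (sym (trans (cong (λ d → u + - d * v) (unitVec-off (f≢e ∘ sym)))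
                                                 (solve 2 (λ u v → u :+ :- con 0ℚ :* v := u) refl u v)))
                             (unitVec-nonNeg f g)
        where u = unitVec f g
              v = unitVec e g
      onFace : ∀ f → unitVec e · (λ g → incidence G δ g + shearedBasis e ψ f g) ≡ incidence G δ e
      onFace f = begin
        unitVec e · (λ g → incidence G δ g + shearedBasis e ψ f g)
          ≡⟨ ·-unitVecˡ e _ ⟩
        incidence G δ e + (unitVec f e + - unitVec e f * unitVec e e)
          ≡⟨ cong₂ (λ u d → incidence G δ e + (u + - unitVec e f * d)) (unitVec-comm f e) (unitVec-diag e) ⟩
        incidence G δ e + (unitVec e f + - unitVec e f * 1ℚ)
          ≡⟨ solve 2 (λ x u → x :+ (u :+ :- u :* con 1ℚ) := x) refl (incidence G δ e) (unitVec e f) ⟩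
        incidence G δ e ∎
        where open ≡-Reasoning

  allBut : Fin (m G) → EdgeSet G
  allBut e f = not (does (f ≟ᶠ e))

  allBut-kept : ∀ {e f} → allBut e f ≡ false → f ≡ e
  allBut-kept {e} {f} kept with f ≟ᶠ e
  ... | yes f≡e = f≡e

  allBut-connected : ∀ {e u v} → Connected G (allBut e) u v → u ≡ v ⊎ Joins G e u v
  allBut-connected here = inj₁ refl
  allBut-connected {e} (step f kept uw conn) with allBut-kept {e} {f} kept | allBut-connected conn
  ... | refl | inj₁ refl = inj₂ uw
  ... | refl | inj₂ wv   = inj₁ (Joins-return uw wv)

  allBut-multicut : ∀ {S} → IsPairSet G S → ∀ e → ¬ S (end₁ G e) (end₂ G e) → IsMulticut G S (allBut e)
  allBut-multicut {S} (symmetric , irrefl) e nonTerminal s t st conn with allBut-connected conn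
  ... | inj₁ refl                 = irrefl s st
  ... | inj₂ (inj₁ (e₁≡s , e₂≡t)) = nonTerminal (subst₂ S (sym e₁≡s) (sym e₂≡t) st)
  ... | inj₂ (inj₂ (e₁≡t , e₂≡s)) = nonTerminal (subst₂ S (sym e₁≡t) (sym e₂≡s) (symmetric s t st))

  module _ {S : Fin' G → Fin' G → Set} (pairSet : IsPairSet G S) (e : Fin (m G)) where

    unitVec-facet : ∀ {b} → Valid (MultC G S) (unitVec e) b →
      HasAffIndep (Face (MultC G S) (unitVec e) b) (m G) → FacetDefining (MultC G S) (unitVec e) b
    unitVec-facet valid face = fullDimensional-facet (MultC G S) (unitVec e) _ valid
      (·-self≢0 e (unitVec-nonNeg e) (unitVec-diag e)) (MultC-fullDimensional S (proj₂ pairSet)) face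

    terminalEdge-facet : S (end₁ G e) (end₂ G e) → FacetDefining (MultC G S) (unitVec e) 1ℚ
    terminalEdge-facet terminal = unitVec-facet
      (MultC-valid S (unitVec-nonNeg e) λ δ cut →
         ≤-reflexive (sym (trans (·-unitVecˡ e _) (incidence-true δ (terminalEdge-cut S cut e terminal)))))
      (edgeFace-affIndep S (allEdges-multicut S (proj₂ pairSet)) e)

    nonTerminalEdge-facet : ¬ S (end₁ G e) (end₂ G e) → FacetDefining (MultC G S) (unitVec e) 0ℚ
    nonTerminalEdge-facet nonTerminal = unitVec-facet
      (MultC-valid S (unitVec-nonNeg e) λ δ _ →
         subst (0ℚ ≤_) (sym (·-unitVecˡ e _)) (incidence-nonNeg δ e))
      (subst (λ b → HasAffIndep (Face (MultC G S) (unitVec e) b) (m G))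
         (incidence-false (allBut e) {e} (cong not (dec-true (e ≟ᶠ e) refl)))
         (edgeFace-affIndep S (allBut-multicut pairSet e nonTerminal) e))

pathVec-· : ∀ {m k} (es : Fin k → Fin m) (x : Vecℚ m) → pathVec es · x ≡ Σℚ k (λ i → x (es i))
pathVec-· {m} {k} es x = begin
  Σℚ m (λ g → Σℚ k (λ i → unitVec (es i) g) * x g) ≡⟨ Σℚ-cong m (λ g → sym (Σℚ-*ʳ k (x g) _)) ⟩
  Σℚ m (λ g → Σℚ k (λ i → unitVec (es i) g * x g)) ≡⟨ Σℚ-comm m k _ ⟩
  Σℚ k (λ i → unitVec (es i) · x)                  ≡⟨ Σℚ-cong k (λ i → ·-unitVecˡ (es i) x) ⟩
  Σℚ k (λ i → x (es i))                            ∎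
  where open ≡-Reasoning

pathVec-nonNeg : ∀ {m k} (es : Fin k → Fin m) g → 0ℚ ≤ pathVec es g
pathVec-nonNeg {k = k} es g = Σℚ-nonNeg k (λ i → unitVec-nonNeg (es i) g)

walk-connected : ∀ {G δ} len (vert : Fin (suc len) → Fin' G) (edge : Fin len → EdgeIx G) →
  (∀ i → Joins G (edge i) (vert (inject₁ i)) (vert (suc i))) → (∀ i → δ (edge i) ≡ false) →
  Connected G δ (vert zero) (vert (fromℕ len))
walk-connected zero    vert edge joins uncut = here
walk-connected (suc len) vert edge joins uncut = step (edge zero) (uncut zero) (joins zero)
  (walk-connected len (vert ∘ suc) (edge ∘ suc) (joins ∘ suc) (uncut ∘ suc))

module _ {G : Graph} {s t : Fin' G} (P : Path G s t) where

  open Path P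

  path-connected : ∀ {δ} → (∀ i → δ (edge i) ≡ false) → Connected G δ s t
  path-connected uncut = subst₂ (Connected G _) start stop (walk-connected len vert edge joins uncut)

  multicut-cuts-path : ∀ {S δ} → S s t → IsMulticut G S δ → ∃ λ i → δ (edge i) ≡ true
  multicut-cuts-path {δ = δ} st cut with any? (λ i → δ (edge i) ≟ᵇ true)
  ... | yes cutEdge = cutEdge
  ... | no  noCut   = contradiction (path-connected uncut) (cut s t st)
    where
    uncut : ∀ i → δ (edge i) ≡ false
    uncut i = ¬-not (λ cutᵢ → noCut (i , cutᵢ))

  path-nonTrivial : s ≢ t → 0 ℕ.< len
  path-nonTrivial s≢t = ℕₚ.n≢0⇒n>0 λ len≡0 → s≢t (trans (sym start) (trans (cong vert (first≡last len≡0)) stop))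
    where
    first≡last : len ≡ 0 → zero ≡ fromℕ len
    first≡last len≡0 = toℕ-injective (sym (trans (toℕ-fromℕ len) len≡0))

  -- An edge traversed twice would revisit a vertex.
  path-edge-injective : ∀ i j → edge i ≡ edge j → i ≡ j
  path-edge-injective i j eᵢ≡eⱼ
    with Joins-endpoints G (joins j)
           (subst (λ e → Joins G e (vert (inject₁ i)) (vert (suc i))) eᵢ≡eⱼ (joins i))
  ... | inj₁ (same , _) = inject₁-injective (injV _ _ same)
  ... | inj₂ (i≡j+1 , i+1≡j) = ⊥-elim (ℕₚ.<-asym (ℕₚ.≤-reflexive (sym toℕj≡)) (ℕₚ.≤-reflexive (sym toℕi≡)))
    where
    toℕi≡ : toℕ i ≡ suc (toℕ j)
    toℕi≡ = trans (sym (toℕ-inject₁ i)) (cong toℕ (injV _ _ i≡j+1))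
    toℕj≡ : toℕ j ≡ suc (toℕ i)
    toℕj≡ = sym (trans (cong toℕ (injV _ _ i+1≡j)) (toℕ-inject₁ j))

  unitVec-pathEdge : ∀ i j → unitVec (edge i) (edge j) ≡ unitVec i j
  unitVec-pathEdge i j with i ≟ᶠ j
  ... | yes refl = trans (unitVec-diag (edge i)) (sym (unitVec-diag i))
  ... | no  i≢j  = trans (unitVec-off (i≢j ∘ path-edge-injective i j)) (sym (unitVec-off i≢j))

  Σℚ-unitVec-pathEdge : ∀ j → Σℚ len (λ i → unitVec (edge j) (edge i)) ≡ 1ℚ
  Σℚ-unitVec-pathEdge j = trans (Σℚ-cong len (unitVec-pathEdge j)) (Σℚ-unitVec len j)

  pathVec-pathEdge : ∀ j → pathVec edge (edge j) ≡ 1ℚ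
  pathVec-pathEdge j = trans (Σℚ-cong len (λ i → unitVec-comm (edge i) (edge j))) (Σℚ-unitVec-pathEdge j)

  -- The vertex sets v₀ … v_j and v_{j+1} … v_len of the two subpaths of P − e_j.
  Before After : Fin len → Fin' G → Set
  Before j u = ∃ λ k → k Fin.≤ j × vert k ≡ u
  After  j u = ∃ λ k → j Fin.< k × vert k ≡ u

  SameSide : Fin len → Fin' G → Fin' G → Set
  SameSide j u v = (Before j u × Before j v) ⊎ (After j u × After j v)

  Before-After-disjoint : ∀ {j u} → Before j u → After j u → ⊥
  Before-After-disjoint (k , k≤j , refl) (k′ , j<k′ , vk′≡vk) with injV k k′ (sym vk′≡vk)
  ... | refl = ℕₚ.<⇒≱ j<k′ k≤j

  SameSide-sym : ∀ {j u v} → SameSide j u v → SameSide j v u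
  SameSide-sym (inj₁ (bu , bv)) = inj₁ (bv , bu)
  SameSide-sym (inj₂ (au , av)) = inj₂ (av , au)

  SameSide-trans : ∀ {j u w v} → SameSide j u w → SameSide j w v → SameSide j u v
  SameSide-trans (inj₁ (bu , _))  (inj₁ (_ , bv))  = inj₁ (bu , bv)
  SameSide-trans (inj₁ (_ , bw))  (inj₂ (aw , _))  = ⊥-elim (Before-After-disjoint bw aw)
  SameSide-trans (inj₂ (_ , aw))  (inj₁ (bw , _))  = ⊥-elim (Before-After-disjoint bw aw)
  SameSide-trans (inj₂ (au , _))  (inj₂ (_ , av))  = inj₂ (au , av)

  SameSide⇒OnPath : ∀ {j u v} → SameSide j u v → OnPath P u × OnPath P v
  SameSide⇒OnPath (inj₁ ((k , _ , vk) , (k′ , _ , vk′))) = (k , vk) , (k′ , vk′)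
  SameSide⇒OnPath (inj₂ ((k , _ , vk) , (k′ , _ , vk′))) = (k , vk) , (k′ , vk′)

  ¬SameSide-s-t : ∀ {j} → ¬ SameSide j s t
  ¬SameSide-s-t {j} (inj₁ (_ , t-before)) = Before-After-disjoint t-before t-after
    where
    t-after : After j t
    t-after = fromℕ len , subst (toℕ j ℕ.<_) (sym (toℕ-fromℕ len)) (toℕ<n j) , stop
  ¬SameSide-s-t (inj₂ (s-after , _)) = Before-After-disjoint (zero , ℕ.z≤n , start) s-after

  pathEdge-sameSide : ∀ {i j} → i ≢ j → SameSide j (vert (inject₁ i)) (vert (suc i))
  pathEdge-sameSide {i} {j} i≢j with ℕₚ.<-cmp (toℕ i) (toℕ j)
  ... | tri< i<j _ _ = inj₁ ((inject₁ i , subst (ℕ._≤ toℕ j) (sym (toℕ-inject₁ i)) (ℕₚ.<⇒≤ i<j) , refl) ,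
                             (suc i , i<j , refl))
  ... | tri≈ _ i≡j _ = contradiction (toℕ-injective i≡j) i≢j
  ... | tri> _ _ j<i = inj₂ ((inject₁ i , subst (toℕ j ℕ.<_) (sym (toℕ-inject₁ i)) j<i , refl) ,
                             (suc i , ℕₚ.m<n⇒m<1+n j<i , refl))

  Joins-pathEdge-sameSide : ∀ {i j u w} → i ≢ j → Joins G (edge i) u w → SameSide j u w
  Joins-pathEdge-sameSide i≢j uw with Joins-endpoints G (joins _) uw
  ... | inj₁ (refl , refl) = pathEdge-sameSide i≢j
  ... | inj₂ (refl , refl) = SameSide-sym (pathEdge-sameSide i≢j)

  onPath? : ∀ g → Dec (∃ λ i → edge i ≡ g)
  onPath? g = any? (λ i → edge i ≟ᶠ g)

  offPath : EdgeSet G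
  offPath g = not (does (onPath? g))

  cutAt : Fin len → EdgeSet G
  cutAt j g = offPath g ∨ does (g ≟ᶠ edge j)

  cutAt-kept : ∀ {j g} → cutAt j g ≡ false → ∃ λ i → edge i ≡ g × i ≢ j
  cutAt-kept {j} {g} kept with onPath? g | g ≟ᶠ edge j
  ... | yes (i , eᵢ≡g) | no g≢eⱼ = i , eᵢ≡g , λ i≡j → g≢eⱼ (trans (sym eᵢ≡g) (cong edge i≡j))

  cutAt-connected : ∀ {j u v} → Connected G (cutAt j) u v → u ≡ v ⊎ SameSide j u v
  cutAt-connected here = inj₁ refl
  cutAt-connected (step g kept uw conn) with cutAt-kept kept | cutAt-connected conn
  ... | i , refl , i≢j | inj₁ refl = inj₂ (Joins-pathEdge-sameSide i≢j uw)
  ... | i , refl , i≢j | inj₂ wv   = inj₂ (SameSide-trans (Joins-pathEdge-sameSide i≢j uw) wv)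

  incidence-cutAt : ∀ j g → incidence G (cutAt j) g ≡ incidence G offPath g + unitVec (edge j) g
  incidence-cutAt j g with onPath? g | g ≟ᶠ edge j
  ... | yes _ | yes refl = sym (trans (+-identityˡ _) (unitVec-diag (edge j)))
  ... | yes _ | no g≢eⱼ  = sym (trans (+-identityˡ _) (unitVec-off (g≢eⱼ ∘ sym)))
  ... | no g∉P | _       = sym (trans (cong (1ℚ +_) (unitVec-off (λ eⱼ≡g → g∉P (j , eⱼ≡g)))) (+-identityʳ 1ℚ))

  incidence-offPath-pathEdge : ∀ i → incidence G offPath (edge i) ≡ 0ℚ
  incidence-offPath-pathEdge i = incidence-false G offPath (cong not (dec-true (onPath? (edge i)) (i , refl)))

pathInequality-valid : ∀ {G S s t} → S s t → (P : Path G s t) → Valid (MultC G S) (pathVec (Path.edge P)) 1ℚ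
pathInequality-valid {G} {S} st P = MultC-valid G S (pathVec-nonNeg edge) bound
  where
  open Path P
  bound : ∀ δ → IsMulticut G S δ → 1ℚ ≤ pathVec edge · incidence G δ
  bound δ cut with multicut-cuts-path P st cut
  ... | i , cutᵢ = begin
    1ℚ                                    ≡⟨ sym (incidence-true G δ cutᵢ) ⟩
    incidence G δ (edge i)                ≤⟨ term≤Σℚ len (λ i → incidence-nonNeg G δ (edge i)) i ⟩
    Σℚ len (λ i → incidence G δ (edge i)) ≡⟨ sym (pathVec-· edge _) ⟩
    pathVec edge · incidence G δ          ∎
    where open ≤-Reasoning

module _ {G : Graph} {S : Fin' G → Fin' G → Set} (pairSet : IsPairSet G S)
         {s t : Fin' G} (st : S s t) (P : Path G s t)
         (onlyPair : ∀ s′ t′ → S s′ t′ → OnPath P s′ → OnPath P t′ →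
                     (s′ ≡ s × t′ ≡ t) ⊎ (s′ ≡ t × t′ ≡ s))
         where

  open Path P

  cutAt-multicut : ∀ j → IsMulticut G S (cutAt P j)
  cutAt-multicut j s′ t′ st′ conn with cutAt-connected P conn
  ... | inj₁ refl = proj₂ pairSet s′ st′
  ... | inj₂ side with SameSide⇒OnPath P side
  ...   | s′∈P , t′∈P with onlyPair s′ t′ st′ s′∈P t′∈P
  ...     | inj₁ (refl , refl) = ¬SameSide-s-t P side
  ...     | inj₂ (refl , refl) = ¬SameSide-s-t P (SameSide-sym P side)

  j₀ : Fin len
  j₀ = fromℕ< (path-nonTrivial P λ s≡t → proj₂ pairSet s (subst (S s) (sym s≡t) st))

  e₀ : EdgeIx G
  e₀ = edge j₀

  x₀ : Vecℚ (m G)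
  x₀ = incidence G (offPath P)

  -- For f = e_j this is x^{δ_j}; for f ∉ E(P) it is x^{δ_{j₀}} + e_f.
  pathFacePoint : Fin (m G) → Vecℚ (m G)
  pathFacePoint f g = x₀ g + shearedBasis e₀ x₀ f g

  pathFacePoint-∈MultC : ∀ f → MultC G S (pathFacePoint f)
  pathFacePoint-∈MultC f with onPath? P f
  ... | yes (j , refl) = multicut⇒MultC G S (cutAt-multicut j) λ g → ≤-reflexive (begin
    incidence G (cutAt P j) g
      ≡⟨ incidence-cutAt P j g ⟩
    x₀ g + unitVec (edge j) g
      ≡⟨ solve 3 (λ x u v → x :+ u := x :+ (u :+ con 0ℚ :* v)) refl (x₀ g) (unitVec (edge j) g) (unitVec e₀ g) ⟩
    x₀ g + (unitVec (edge j) g + 0ℚ * unitVec e₀ g) ∎)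
    where open ≡-Reasoning
  ... | no _ = multicut⇒MultC G S (cutAt-multicut j₀) λ g → begin
    incidence G (cutAt P j₀) g         ≡⟨ incidence-cutAt P j₀ g ⟩
    x₀ g + unitVec e₀ g                ≤⟨ p≤p+q _ (unitVec-nonNeg f g) ⟩
    x₀ g + unitVec e₀ g + unitVec f g  ≡⟨ solve 3 (λ x v u → x :+ v :+ u := x :+ (u :+ con 1ℚ :* v)) refl (x₀ g) _ _ ⟩
    x₀ g + (unitVec f g + 1ℚ * unitVec e₀ g) ∎
    where open ≤-Reasoning

  pathFacePoint-onFace : ∀ f → pathVec edge · pathFacePoint f ≡ 1ℚ
  pathFacePoint-onFace f with onPath? P f
  ... | yes (j , refl) = trans (pathVec-· edge _) (trans (Σℚ-cong len onPathEdge) (Σℚ-unitVec-pathEdge P j))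
    where
    onPathEdge : ∀ i → x₀ (edge i) + (unitVec (edge j) (edge i) + 0ℚ * unitVec e₀ (edge i))
                     ≡ unitVec (edge j) (edge i)
    onPathEdge i = trans (cong₂ _+_ (incidence-offPath-pathEdge P i) refl)
      (solve 2 (λ u v → con 0ℚ :+ (u :+ con 0ℚ :* v) := u) refl (unitVec (edge j) (edge i)) (unitVec e₀ (edge i)))
  ... | no f∉P = trans (pathVec-· edge _) (trans (Σℚ-cong len onPathEdge) (Σℚ-unitVec-pathEdge P j₀))
    where
    onPathEdge : ∀ i → x₀ (edge i) + (unitVec f (edge i) + 1ℚ * unitVec e₀ (edge i)) ≡ unitVec e₀ (edge i)
    onPathEdge i = trans (cong₂ (λ x u → x + (u + 1ℚ * unitVec e₀ (edge i)))
                           (incidence-offPath-pathEdge P i) (unitVec-off (λ f≡eᵢ → f∉P (i , sym f≡eᵢ))))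
      (solve 1 (λ v → con 0ℚ :+ (con 0ℚ :+ con 1ℚ :* v) := v) refl (unitVec e₀ (edge i)))

  path-facet : FacetDefining (MultC G S) (pathVec edge) 1ℚ
  path-facet = fullDimensional-facet (MultC G S) (pathVec edge) 1ℚ (pathInequality-valid st P)
    (·-self≢0 e₀ (pathVec-nonNeg edge) (pathVec-pathEdge P j₀))
    (MultC-fullDimensional G S (proj₂ pairSet))
    (pathFacePoint , (λ f → pathFacePoint-∈MultC f , pathFacePoint-onFace f) ,
     affIndep-translate x₀ (shearedBasis e₀ x₀) (shearedBasis-affIndep e₀ x₀))

corollary3p12 : (G : Graph) → IsSimple G →
    (S : Fin' G → Fin' G → Set) → IsPairSet G S →
    (s t : Fin' G) → S s t →
    ((e : EdgeIx G) →
       (S (end₁ G e) (end₂ G e) → FacetDefining (MultC G S) (unitVec e) 1ℚ) ×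
       (¬ S (end₁ G e) (end₂ G e) → FacetDefining (MultC G S) (unitVec e) 0ℚ)) ×
    ((P : Path G s t) →
       (∀ s' t' → S s' t' → OnPath P s' → OnPath P t' →
          (s' ≡ s × t' ≡ t) ⊎ (s' ≡ t × t' ≡ s)) →
       FacetDefining (MultC G S) (pathVec (Path.edge P)) 1ℚ)
corollary3p12 G _ S pairSet s t st =
  (λ e → terminalEdge-facet G pairSet e , nonTerminalEdge-facet G pairSet e) ,
  (λ P onlyPair → path-facet pairSet st P onlyPair)
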